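{- Let $G$ be a finite acyclic directed graph (multiple edges allowed) with edge set $E(G)$, and let $\prec$ be a linear order on $E(G)$. Then the following two conditions are equivalent. (A) The order $\prec$ satisfies: (U1) for all edges $e_1,e_2$, if $e_1\to e_2$ then $e_1\prec e_2$; (U2) for every vertex $v$, $\overline{I(v)}\cap\overline{O(v)}=\emptyset$ and $\overline{E(v)}=\overline{I(v)}\sqcup\overline{O(v)}$; (U3) for any two vertices $v_1,v_2$: if $I(v_1)\cap\overline{I(v_2)}\neq\emptyset$ then $\overline{I(v_1)}\subseteq\overline{I(v_2)}$, and if $O(v_1)\cap\overline{O(v_2)}\neq\emptyset$ then $\overline{O(v_1)}\subseteq\overline{O(v_2)}$. (B) The order $\prec$ satisfies: (Q1) for all edges $e_1,e_2$, if $e_1\to e_2$ then $e_1\prec e_2$; (Q2) for all edges $e_1,e,e_2$ with $e_1\prec e\prec e_2$ such that $e_1$ and $e_2$ are adjacent (share a vertex $v$): – if $t(e_1)=t(e_2)=v$, then $I(t(e))\subseteq\overline{I(v)}$; – if $s(e_1)=s(e_2)=v$, then $O(s(e))\subseteq\overline{O(v)}$; – if $t(e_1)=s(e_2)=v$, then $I(t(e))\subseteq\overline{I(v)}$ or $O(s(e))\subseteq\overline{O(v)}$.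
   Context: For a finite set $S$ with a linear order and a subset $X\subseteq S$, the convex hull of $X$ in $S$ is the closed interval $\overline{X}=\{y\in S : \min X\le y\le \max X\}$ (with $\overline{\emptyset}=\emptyset$); here $S=E(G)$ ordered by $\prec$. For an edge $e$, $s(e)$ and $t(e)$ denote its source and target vertices. For a vertex $v$, $I(v)$ is the set of incoming edges of $v$ (edges with $t(e)=v$), $O(v)$ the set of outgoing edges ($s(e)=v$), and $E(v)=I(v)\sqcup O(v)$ the set of incident edges. For edges $e_1,e_2$, $e_1\to e_2$ means there is a directed path in $G$ starting with edge $e_1$ and ending with edge $e_2$ (this is a partial order on $E(G)$ since $G$ is acyclic). A linear order satisfying (A) (equivalently (B)) is called an upward planar order. -}

module Defs where

open import Level using (0ℓ)
open import Data.Nat using (ℕ)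
open import Data.Fin using (Fin)
open import Data.Product using (Σ; ∃; _×_; _,_)
open import Data.Sum using (_⊎_)
open import Data.Empty using (⊥)
open import Relation.Nullary using (¬_)
open import Relation.Binary.Core using (Rel)
open import Relation.Binary.PropositionalEquality using (_≡_)

module Graph {n m : ℕ} (s t : Fin m → Fin n) where

  Edge : Set
  Edge = Fin m

  Vertex : Set
  Vertex = Fin n

  -- e₁ → e₂ : a directed path starting with edge e₁ and ending with e₂
  -- (the length-one path gives e → e, so this is reflexive).
  data _⇝_ : Edge → Edge → Set where
    here : ∀ {e} → e ⇝ e
    step : ∀ {e f g} → t e ≡ s f → f ⇝ g → e ⇝ g

  Acyclic : Set
  Acyclic = ∀ e f → e ⇝ f → ¬ (t f ≡ s e)

  Subset : Set₁
  Subset = Edge → Set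

  I : Vertex → Subset
  I v e = t e ≡ v

  O : Vertex → Subset
  O v e = s e ≡ v

  E : Vertex → Subset
  E v e = I v e ⊎ O v e

  _⊆_ : Subset → Subset → Set
  X ⊆ Y = ∀ e → X e → Y e

  module Order (_≺_ : Rel Edge 0ℓ) where

    _⪯_ : Edge → Edge → Set
    a ⪯ b = a ≺ b ⊎ a ≡ b

    -- convex hull: {y | min X ⪯ y ⪯ max X}, i.e. y lies between
    -- two elements of X (empty for X empty)
    hull : Subset → Subset
    hull X y = Σ Edge λ a → Σ Edge λ b → X a × X b × a ⪯ y × y ⪯ b

    -- (U1) = (Q1)
    Monotone : Set
    Monotone = ∀ e₁ e₂ → e₁ ⇝ e₂ → e₁ ⪯ e₂

    U2 : Set
    U2 = ∀ v →
      (∀ e → ¬ (hull (I v) e × hull (O v) e))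
      × (∀ e → hull (E v) e → hull (I v) e ⊎ hull (O v) e)
      × (∀ e → hull (I v) e ⊎ hull (O v) e → hull (E v) e)

    U3 : Set
    U3 = ∀ v₁ v₂ →
      ((∃ λ e → I v₁ e × hull (I v₂) e) → hull (I v₁) ⊆ hull (I v₂))
      × ((∃ λ e → O v₁ e × hull (O v₂) e) → hull (O v₁) ⊆ hull (O v₂))

    ConditionA : Set
    ConditionA = Monotone × U2 × U3

    Q2 : Set
    Q2 = ∀ e₁ e e₂ → e₁ ≺ e → e ≺ e₂ → ∀ v →
      (t e₁ ≡ v → t e₂ ≡ v → I (t e) ⊆ hull (I v))
      × (s e₁ ≡ v → s e₂ ≡ v → O (s e) ⊆ hull (O v))
      × (t e₁ ≡ v → s e₂ ≡ v → I (t e) ⊆ hull (I v) ⊎ O (s e) ⊆ hull (O v))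

    ConditionB : Set
    ConditionB = Monotone × Q2

{-# OPTIONS --safe #-}
-- Both conditions are about how the fibres of t (the sets I(v)) and of s
-- (the sets O(v)) sit in the order. (U3) says that a fibre meeting the hull
-- of another fibre lies in that hull; since a hull is the least convex
-- superset, it suffices that every edge e strictly inside the hull of a fibre
-- drags its whole fibre into that hull, which is the first two clauses of
-- (Q2). For (U2), monotonicity and acyclicity put every incoming edge of v
-- strictly before every outgoing one, so the two hulls are disjoint and an
-- edge in the hull of E(v) is either an endpoint, or lies between two edges
-- of the same kind, or lies between an incoming and an outgoing edge, where
-- the third clause of (Q2) is exactly what is needed.
module Submission where

open import Defs
open import Level using (0ℓ)
open import Data.Nat using (ℕ)
open import Data.Fin using (Fin)
open import Data.Product using (Σ; ∃; _×_; _,_; proj₁; proj₂)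
open import Data.Sum using (_⊎_; inj₁; inj₂; [_,_])
open import Data.Empty using (⊥; ⊥-elim)
open import Relation.Binary.Core using (Rel)
open import Relation.Binary.Structures using (IsStrictPartialOrder; IsStrictTotalOrder)
open import Relation.Binary.PropositionalEquality using (_≡_; refl; sym; trans)

module HullProperties {n m : ℕ} (s t : Fin m → Fin n)
  (_≺_ : Rel (Fin m) 0ℓ) (spo : IsStrictPartialOrder _≡_ _≺_) where
  open Graph s t
  open Order _≺_
  open IsStrictPartialOrder spo using (irrefl) renaming (trans to ≺-trans)

  ⪯-trans : ∀ {a b c} → a ⪯ b → b ⪯ c → a ⪯ c
  ⪯-trans (inj₁ a≺b) (inj₁ b≺c) = inj₁ (≺-trans a≺b b≺c)
  ⪯-trans (inj₁ a≺b) (inj₂ refl) = inj₁ a≺b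
  ⪯-trans (inj₂ refl) b⪯c = b⪯c

  ≺⇒⋡ : ∀ {a b} → a ≺ b → b ⪯ a → ⊥
  ≺⇒⋡ a≺b (inj₁ b≺a) = irrefl refl (≺-trans a≺b b≺a)
  ≺⇒⋡ a≺b (inj₂ refl) = irrefl refl a≺b

  Between : Subset → Subset
  Between X e = Σ Edge λ a → Σ Edge λ b → X a × X b × a ≺ e × e ≺ b

  ⊆-hull : ∀ {X} → X ⊆ hull X
  ⊆-hull e Xe = e , e , Xe , Xe , inj₂ refl , inj₂ refl

  Between⊆hull : ∀ {X} → Between X ⊆ hull X
  Between⊆hull e (a , b , Xa , Xb , a≺e , e≺b) = a , b , Xa , Xb , inj₁ a≺e , inj₁ e≺b

  hull-endpoint-or-Between : ∀ {X e} → hull X e → X e ⊎ Between X e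
  hull-endpoint-or-Between (a , b , Xa , Xb , inj₂ refl , _) = inj₁ Xa
  hull-endpoint-or-Between (a , b , Xa , Xb , inj₁ _ , inj₂ refl) = inj₁ Xb
  hull-endpoint-or-Between (a , b , Xa , Xb , inj₁ a≺e , inj₁ e≺b) =
    inj₂ (a , b , Xa , Xb , a≺e , e≺b)

  hull-convex : ∀ {X c d y} → hull X c → hull X d → c ⪯ y → y ⪯ d → hull X y
  hull-convex (a , _ , Xa , _ , a⪯c , _) (_ , b , _ , Xb , _ , d⪯b) c⪯y y⪯d =
    a , b , Xa , Xb , ⪯-trans a⪯c c⪯y , ⪯-trans y⪯d d⪯b

  hull-least : ∀ {X Y} → X ⊆ hull Y → hull X ⊆ hull Y
  hull-least X⊆Y y (c , d , Xc , Xd , c⪯y , y⪯d) =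
    hull-convex (X⊆Y c Xc) (X⊆Y d Xd) c⪯y y⪯d

  hull-mono : ∀ {X Y} → X ⊆ Y → hull X ⊆ hull Y
  hull-mono X⊆Y = hull-least λ e Xe → ⊆-hull e (X⊆Y e Xe)

  hull-disjoint : ∀ {X Y e} → (∀ {a b} → X a → Y b → a ≺ b) →
    hull X e → hull Y e → ⊥
  hull-disjoint X≺Y (_ , b , _ , Xb , _ , e⪯b) (c , _ , Yc , _ , c⪯e , _) =
    ≺⇒⋡ (X≺Y Xb Yc) (⪯-trans c⪯e e⪯b)

  -- I v and O v are the fibres of t and s over v, so every statement about
  -- fibres of an arbitrary map h covers both.
  fibre : (Edge → Vertex) → Vertex → Subset
  fibre h v e = h e ≡ v

  FibresNested : (Edge → Vertex) → Set
  FibresNested h = ∀ v₁ v₂ → (∃ λ e → h e ≡ v₁ × hull (fibre h v₂) e) →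
    hull (fibre h v₁) ⊆ hull (fibre h v₂)

  FibresConvex : (Edge → Vertex) → Set
  FibresConvex h = ∀ v e → hull (fibre h v) e → fibre h (h e) ⊆ hull (fibre h v)

  FibresBetweenClosed : (Edge → Vertex) → Set
  FibresBetweenClosed h = ∀ e₁ e e₂ → e₁ ≺ e → e ≺ e₂ → ∀ v →
    h e₁ ≡ v → h e₂ ≡ v → fibre h (h e) ⊆ hull (fibre h v)

  FibresNested⇒FibresConvex : ∀ h → FibresNested h → FibresConvex h
  FibresNested⇒FibresConvex h nested v e e∈hull f hf≡he =
    nested (h e) v (e , refl , e∈hull) f (⊆-hull f hf≡he)

  FibresConvex⇒FibresNested : ∀ h → FibresConvex h → FibresNested h
  FibresConvex⇒FibresNested h convex v₁ v₂ (e , refl , e∈hull) =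
    hull-least (convex v₂ e e∈hull)

  FibresConvex⇒FibresBetweenClosed : ∀ h → FibresConvex h → FibresBetweenClosed h
  FibresConvex⇒FibresBetweenClosed h convex e₁ e e₂ e₁≺e e≺e₂ v he₁ he₂ =
    convex v e (Between⊆hull e (e₁ , e₂ , he₁ , he₂ , e₁≺e , e≺e₂))

  FibresBetweenClosed⇒FibresConvex : ∀ h → FibresBetweenClosed h → FibresConvex h
  FibresBetweenClosed⇒FibresConvex h closed v e e∈hull f hf≡he
    with hull-endpoint-or-Between e∈hull
  ... | inj₁ he≡v = ⊆-hull f (trans hf≡he he≡v)
  ... | inj₂ (a , b , ha , hb , a≺e , e≺b) = closed a e b a≺e e≺b v ha hb f hf≡he

module Equivalence {n m : ℕ} (s t : Fin m → Fin n) (acyclic : Graph.Acyclic s t)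
  (_≺_ : Rel (Fin m) 0ℓ) (spo : IsStrictPartialOrder _≡_ _≺_) where
  open Graph s t
  open Order _≺_
  open HullProperties s t _≺_ spo

  incoming≺outgoing : Monotone → ∀ {v a b} → t a ≡ v → s b ≡ v → a ≺ b
  incoming≺outgoing mono {a = a} {b} ta≡v sb≡v
    with mono a b (step (trans ta≡v (sym sb≡v)) here)
  ... | inj₁ a≺b = a≺b
  ... | inj₂ refl = ⊥-elim (acyclic a a here (trans ta≡v (sym sb≡v)))

  U3⇒FibresConvex : U3 → FibresConvex t × FibresConvex s
  U3⇒FibresConvex u3 =
      FibresNested⇒FibresConvex t (λ v₁ v₂ → proj₁ (u3 v₁ v₂))
    , FibresNested⇒FibresConvex s (λ v₁ v₂ → proj₂ (u3 v₁ v₂))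

  FibresConvex⇒U3 : FibresConvex t → FibresConvex s → U3
  FibresConvex⇒U3 convex-t convex-s v₁ v₂ =
      FibresConvex⇒FibresNested t convex-t v₁ v₂
    , FibresConvex⇒FibresNested s convex-s v₁ v₂

  ConditionA⇒ConditionB : ConditionA → ConditionB
  ConditionA⇒ConditionB (mono , u2 , u3) = mono , q2
    where
    convex-t : FibresConvex t
    convex-t = proj₁ (U3⇒FibresConvex u3)

    convex-s : FibresConvex s
    convex-s = proj₂ (U3⇒FibresConvex u3)

    q2 : Q2
    q2 e₁ e e₂ e₁≺e e≺e₂ v =
        FibresConvex⇒FibresBetweenClosed t convex-t e₁ e e₂ e₁≺e e≺e₂ v
      , FibresConvex⇒FibresBetweenClosed s convex-s e₁ e e₂ e₁≺e e≺e₂ v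
      , λ te₁ se₂ →
          [ (λ h → inj₁ (convex-t v e h)) , (λ h → inj₂ (convex-s v e h)) ]
          (proj₁ (proj₂ (u2 v)) e
            (Between⊆hull e (e₁ , e₂ , inj₁ te₁ , inj₂ se₂ , e₁≺e , e≺e₂)))

  hull-E-split : Monotone → Q2 → ∀ v → hull (E v) ⊆ λ e → hull (I v) e ⊎ hull (O v) e
  hull-E-split mono q2 v e e∈hull with hull-endpoint-or-Between e∈hull
  ... | inj₁ (inj₁ Ie) = inj₁ (⊆-hull e Ie)
  ... | inj₁ (inj₂ Oe) = inj₂ (⊆-hull e Oe)
  ... | inj₂ (a , b , inj₁ Ia , inj₁ Ib , a≺e , e≺b) =
    inj₁ (Between⊆hull e (a , b , Ia , Ib , a≺e , e≺b))
  ... | inj₂ (a , b , inj₂ Oa , inj₂ Ob , a≺e , e≺b) =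
    inj₂ (Between⊆hull e (a , b , Oa , Ob , a≺e , e≺b))
  ... | inj₂ (a , b , inj₂ Oa , inj₁ Ib , a≺e , e≺b) =
    ⊥-elim (≺⇒⋡ (incoming≺outgoing mono Ib Oa) (⪯-trans (inj₁ a≺e) (inj₁ e≺b)))
  ... | inj₂ (a , b , inj₁ Ia , inj₂ Ob , a≺e , e≺b) =
    [ (λ I⊆ → inj₁ (I⊆ e refl)) , (λ O⊆ → inj₂ (O⊆ e refl)) ]
    (proj₂ (proj₂ (q2 a e b a≺e e≺b v)) Ia Ob)

  ConditionB⇒ConditionA : ConditionB → ConditionA
  ConditionB⇒ConditionA (mono , q2) = mono , u2 , u3
    where
    u2 : U2
    u2 v =
        (λ e (inI , inO) → hull-disjoint (incoming≺outgoing mono) inI inO)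
      , hull-E-split mono q2 v
      , λ e → [ hull-mono (λ _ → inj₁) e , hull-mono (λ _ → inj₂) e ]

    u3 : U3
    u3 = FibresConvex⇒U3
      (FibresBetweenClosed⇒FibresConvex t λ e₁ e e₂ e₁≺e e≺e₂ v →
        proj₁ (q2 e₁ e e₂ e₁≺e e≺e₂ v))
      (FibresBetweenClosed⇒FibresConvex s λ e₁ e e₂ e₁≺e e≺e₂ v →
        proj₁ (proj₂ (q2 e₁ e e₂ e₁≺e e≺e₂ v)))

mainTheorem1 : ∀ {n m : ℕ} (s t : Fin m → Fin n) → Graph.Acyclic s t →
    (_≺_ : Rel (Fin m) 0ℓ) → IsStrictTotalOrder _≡_ _≺_ →
    (Graph.Order.ConditionA s t _≺_ → Graph.Order.ConditionB s t _≺_)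
    × (Graph.Order.ConditionB s t _≺_ → Graph.Order.ConditionA s t _≺_)
mainTheorem1 s t acyclic _≺_ sto =
  ConditionA⇒ConditionB , ConditionB⇒ConditionA
  where open Equivalence s t acyclic _≺_ (IsStrictTotalOrder.isStrictPartialOrder sto)
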